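{- For integers $r\ge0$, $n\ge2$ and $i>-n$, $$b^r(n,i)=1+(n+i)\sum_{j=0}^{\lfloor r/2\rfloor-1}(n-1)^j.$$
   Context: $\mathcal{T}(n,i)$ is the infinite rooted tree whose root $v_0$ has degree $n+i$ and every other vertex has degree $n$; $\mathcal{T}^r(n,i)$ is the subgraph induced on vertices at distance $\le r$ from $v_0$. An undirected graph is viewed as a directed graph with one arc in each direction per edge, so $\deg(v,P)$ is the number of neighbours of $v$ in $P$. A vertex subset $P$ of a graph is a polar condition if for every vertex $v$, $\deg(v,P)=1$ implies $v\in P$. A nonempty subset $Q$ of vertices of a tree $\mathcal{T}$ is quasipolar if for every vertex $v$, $\deg(v,Q)=1$ implies $v\in Q$ or $v$ is a leaf of $\mathcal{T}$. Define $b^r(n,i)=\min|P\cap\mathcal{T}^r(n,i)|$ over polar conditions $P$ on $\mathcal{T}(n,i)$ containing $v_0$; equivalently the minimum of $|Q|$ over quasipolar $Q\subseteq\mathcal{T}^r(n,i)$ containing $v_0$. -}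

module Defs where

open import Data.Nat using (ℕ; zero; suc; _+_; _*_; _∸_; _^_; _≤_)
open import Data.Bool using (Bool; true; false)
open import Data.Fin using (Fin)
open import Data.List using (List; map; allFin)
open import Data.Nat.ListAction using (sum)
open import Data.Product using (Σ; _×_)
open import Relation.Binary.PropositionalEquality using (_≡_)

-- The rooted tree T(n,i) is presented with two parameters:
--   k = n + i : number of children (= degree) of the root v₀,
--   m = n - 1 : number of children of every non-root vertex
--               (so every non-root vertex has degree m + 1 = n).

data Path (k m : ℕ) : Set where
  top : Fin k → Path k m
  ext : Path k m → Fin m → Path k m

data Vertex (k m : ℕ) : Set where
  root : Vertex k m
  node : Path k m → Vertex k m

parent : ∀ {k m} → Path k m → Vertex k m
parent (top c)   = root
parent (ext p c) = node p

VSet : ℕ → ℕ → Set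
VSet k m = Vertex k m → Bool

b2n : Bool → ℕ
b2n true  = 1
b2n false = 0

count : (j : ℕ) → (Fin j → ℕ) → ℕ
count j f = sum (map f (allFin j))

deg : ∀ {k m} → VSet k m → Vertex k m → ℕ
deg {k} {m} P root     = count k (λ c → b2n (P (node (top c))))
deg {k} {m} P (node p) = b2n (P (parent p)) + count m (λ c → b2n (P (node (ext p c))))

Polar : ∀ {k m} → VSet k m → Set
Polar P = ∀ v → deg P v ≡ 1 → P v ≡ true

cnt : ∀ {k m} → VSet k m → ℕ → Vertex k m → ℕ
cnt P zero v = b2n (P v)
cnt {k} {m} P (suc r) root     = b2n (P root) + count k (λ c → cnt P r (node (top c)))
cnt {k} {m} P (suc r) (node p) = b2n (P (node p)) + count m (λ c → cnt P r (node (ext p c)))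

sizeUpTo : ∀ {k m} → VSet k m → ℕ → ℕ
sizeUpTo P r = cnt P r root

IsBr : (r k m b : ℕ) → Set
IsBr r k m b =
  (Σ (VSet k m) λ P → Polar P × (P root ≡ true) × (sizeUpTo P r ≡ b))
  × (∀ (P : VSet k m) → Polar P → P root ≡ true → b ≤ sizeUpTo P r)

{-# OPTIONS --safe #-}
module Submission where

-- Below a vertex v in a polar set P, each child of v either lies in P or, having degree 1
-- otherwise, has a child in P; so within depth t below v the set P has at least
-- 1 + (#children of v)·geomHalf m t vertices, where geomHalf m (t+2) = 1 + m·geomHalf m t.
-- Equality holds for the set consisting of the root and, below each of its members, the
-- first child of every child: in it every non-root vertex has degree 0 or 2.

open import Defs
open import Data.Nat using (ℕ; _∸_; _^_; _≤_)
open import Data.Nat.DivMod using (_/_)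
open import Data.Integer using (ℤ; +_; -_; _<_; _+_; _*_; ∣_∣)
open import Data.List using (map; upTo)
open import Data.Nat.ListAction using (sum)
open import Data.Product using (Σ; _×_)
open import Relation.Binary.PropositionalEquality using (_≡_)

open import Data.Bool using (Bool; true; false; _∧_)
open import Data.Bool.Properties using (¬-not) renaming (_≟_ to _≟ᵇ_)
open import Data.Empty using (⊥-elim)
open import Data.Fin using (Fin; zero; suc)
open import Data.Fin.Properties using (any?)
open import Data.Integer using (0ℤ) renaming (_≤_ to _≤ℤ_)
open import Data.Integer.Properties as ℤ using ()
open import Data.List using (applyUpTo)
open import Data.List.Properties using (map-tabulate; map-upTo)
open import Data.Nat as ℕ using (zero; suc; z≤n; s≤s)
open import Data.Nat.DivMod using (m/n≡1+[m∸n]/n)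
open import Data.Nat.Properties as ℕ using ()
open import Data.Product using (_,_; ∃)
open import Function using (_∘_; id)
open import Relation.Nullary using (¬_; yes; no)
open import Relation.Binary.PropositionalEquality
  using (refl; sym; trans; cong; cong₂; subst; module ≡-Reasoning)

count-suc : ∀ j (f : Fin (suc j) → ℕ) → count (suc j) f ≡ f zero ℕ.+ count j (f ∘ suc)
count-suc j f = cong (f zero ℕ.+_) (cong sum
  (trans (map-tabulate suc f) (sym (map-tabulate id (f ∘ suc)))))

count-const : ∀ j x (f : Fin j → ℕ) → (∀ c → f c ≡ x) → count j f ≡ j ℕ.* x
count-const zero    x f f≡x = refl
count-const (suc j) x f f≡x = trans (count-suc j f)
  (cong₂ ℕ._+_ (f≡x zero) (count-const j x (f ∘ suc) (f≡x ∘ suc)))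

count-zero : ∀ j (f : Fin j → ℕ) → (∀ c → f c ≡ 0) → count j f ≡ 0
count-zero j f f≡0 = trans (count-const j 0 f f≡0) (ℕ.*-zeroʳ j)

count-≥ : ∀ j x (f : Fin j → ℕ) → (∀ c → x ≤ f c) → j ℕ.* x ≤ count j f
count-≥ zero    x f x≤f = z≤n
count-≥ (suc j) x f x≤f = ℕ.≤-trans
  (ℕ.+-mono-≤ (x≤f zero) (count-≥ j x (f ∘ suc) (x≤f ∘ suc))) (ℕ.≤-reflexive (sym (count-suc j f)))

count-elem : ∀ j (f : Fin j → ℕ) c → f c ≤ count j f
count-elem (suc j) f c = ℕ.≤-trans (elem c) (ℕ.≤-reflexive (sym (count-suc j f)))
  where
  elem : ∀ c → f c ≤ f zero ℕ.+ count j (f ∘ suc)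
  elem zero    = ℕ.m≤m+n _ _
  elem (suc c) = ℕ.≤-trans (count-elem j (f ∘ suc) c) (ℕ.m≤n+m _ (f zero))

sum-applyUpTo-*ˡ : ∀ c (f : ℕ → ℕ) u → sum (applyUpTo (λ j → c ℕ.* f j) u) ≡ c ℕ.* sum (applyUpTo f u)
sum-applyUpTo-*ˡ c f zero    = sym (ℕ.*-zeroʳ c)
sum-applyUpTo-*ˡ c f (suc u) = trans (cong (c ℕ.* f 0 ℕ.+_) (sum-applyUpTo-*ˡ c (f ∘ suc) u))
  (sym (ℕ.*-distribˡ-+ c (f 0) _))

geometric-suc : ∀ m u → sum (map (m ^_) (upTo (suc u))) ≡ 1 ℕ.+ m ℕ.* sum (map (m ^_) (upTo u))
geometric-suc m u = begin
  sum (map (m ^_) (upTo (suc u)))         ≡⟨ cong sum (map-upTo (m ^_) (suc u)) ⟩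
  1 ℕ.+ sum (applyUpTo (λ j → m ℕ.* m ^ j) u) ≡⟨ cong (1 ℕ.+_) (sum-applyUpTo-*ˡ m (m ^_) u) ⟩
  1 ℕ.+ m ℕ.* sum (applyUpTo (m ^_) u)    ≡⟨ cong (λ xs → 1 ℕ.+ m ℕ.* sum xs) (map-upTo (m ^_) u) ⟨
  1 ℕ.+ m ℕ.* sum (map (m ^_) (upTo u))   ∎
  where open ≡-Reasoning

-- Σ_{j < ⌊r/2⌋} m^j (geomHalf≡sum), given by the recursion that the counting arguments follow.
geomHalf : ℕ → ℕ → ℕ
geomHalf m zero            = 0
geomHalf m (suc zero)      = 0
geomHalf m (suc (suc r))   = 1 ℕ.+ m ℕ.* geomHalf m r

geomHalf-mono : ∀ m r → geomHalf m r ≤ geomHalf m (suc r)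
geomHalf-mono m zero          = z≤n
geomHalf-mono m (suc zero)    = z≤n
geomHalf-mono m (suc (suc r)) = s≤s (ℕ.*-monoʳ-≤ m (geomHalf-mono m r))

geomHalf≡sum : ∀ m r → geomHalf m r ≡ sum (map (m ^_) (upTo (r / 2)))
geomHalf≡sum m zero          = refl
geomHalf≡sum m (suc zero)    = refl
geomHalf≡sum m (suc (suc r)) = begin
  1 ℕ.+ m ℕ.* geomHalf m r                        ≡⟨ cong (λ x → 1 ℕ.+ m ℕ.* x) (geomHalf≡sum m r) ⟩
  1 ℕ.+ m ℕ.* sum (map (m ^_) (upTo (r / 2)))     ≡⟨ geometric-suc m (r / 2) ⟨
  sum (map (m ^_) (upTo (suc (r / 2))))           ≡⟨ cong (λ u → sum (map (m ^_) (upTo u)))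
                                                       (m/n≡1+[m∸n]/n {2 ℕ.+ r} {2} (s≤s (s≤s z≤n))) ⟨
  sum (map (m ^_) (upTo (suc (suc r) / 2)))       ∎
  where open ≡-Reasoning

true≢false : ¬ true ≡ false
true≢false ()

module _ {k m : ℕ} where

  arity : Vertex k m → ℕ
  arity root     = k
  arity (node _) = m

  child : (v : Vertex k m) → Fin (arity v) → Path k m
  child root     c = top c
  child (node p) c = ext p c

  parent-child : ∀ v c → parent (child v c) ≡ v
  parent-child root     c = refl
  parent-child (node p) c = refl

  cnt-suc : ∀ (P : VSet k m) t v →
            cnt P (suc t) v ≡ b2n (P v) ℕ.+ count (arity v) (λ c → cnt P t (node (child v c)))
  cnt-suc P t root     = refl
  cnt-suc P t (node p) = refl

  polar-child : ∀ (P : VSet k m) → Polar P → ∀ p → P (parent p) ≡ true → P (node p) ≡ false →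
                ∃ λ c → P (node (ext p c)) ≡ true
  polar-child P polar p Ppar Pp with any? (λ c → P (node (ext p c)) ≟ᵇ true)
  ... | yes found = found
  ... | no none   = ⊥-elim (true≢false (trans (sym (polar (node p) deg≡1)) Pp))
    where
    deg≡1 : deg P (node p) ≡ 1
    deg≡1 = cong₂ ℕ._+_ (cong b2n Ppar)
      (count-zero m _ (λ c → cong b2n (¬-not (λ Pc → none (c , Pc)))))

  module LowerBound (P : VSet k m) (polar : Polar P) where
    mutual
      cnt-≥-in : ∀ t v → P v ≡ true → 1 ℕ.+ arity v ℕ.* geomHalf m t ≤ cnt P t v
      cnt-≥-in zero    v Pv rewrite Pv | ℕ.*-zeroʳ (arity v) = s≤s z≤n
      cnt-≥-in (suc t) v Pv rewrite cnt-suc P t v | Pv = s≤s (children-≥ t v Pv)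

      children-≥ : ∀ t v → P v ≡ true →
                   arity v ℕ.* geomHalf m (suc t) ≤ count (arity v) (λ c → cnt P t (node (child v c)))
      children-≥ t v Pv = count-≥ (arity v) _ _
        (λ c → cnt-≥-below t (child v c) (trans (cong P (parent-child v c)) Pv))

      cnt-≥-below : ∀ t p → P (parent p) ≡ true → geomHalf m (suc t) ≤ cnt P t (node p)
      cnt-≥-below zero    p Ppar = z≤n
      cnt-≥-below (suc t) p Ppar with P (node p) in Pp
      ... | true  = s≤s (ℕ.≤-trans (ℕ.*-monoʳ-≤ m (geomHalf-mono m t)) (children-≥ t (node p) Pp))
      ... | false with polar-child P polar p Ppar Pp
      ...   | c , Pc = ℕ.≤-trans (cnt-≥-in t (node (ext p c)) Pc)
                         (count-elem m (λ c → cnt P t (node (ext p c))) c)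

isZero : ∀ {j} → Fin j → Bool
isZero zero    = true
isZero (suc _) = false

module Extremal (k m′ : ℕ) where
  m : ℕ
  m = suc m′

  inQ : Path k m → Bool
  inQ (top c)             = false
  inQ (ext (top c) d)     = isZero d
  inQ (ext (ext p c) d)   = inQ p ∧ isZero d

  Q : VSet k m
  Q root     = true
  Q (node p) = inQ p

  Q-ext : ∀ p d → Q (node (ext p d)) ≡ Q (parent p) ∧ isZero d
  Q-ext (top c)   d = refl
  Q-ext (ext p c) d = refl

  Q-independent : ∀ p → Q (parent p) ≡ true → Q (node p) ≡ false
  Q-independent (top c)   _    = refl
  Q-independent (ext p c) Qp rewrite Q-ext p c with Q (parent p) in Qpp
  ... | false = refl
  ... | true  = ⊥-elim (true≢false (trans (sym Qp) (Q-independent p Qpp)))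

  count-children-Q : ∀ p → count m (λ d → b2n (Q (node (ext p d)))) ≡ b2n (Q (parent p))
  count-children-Q p with Q (parent p) in Qpar
  ... | true  = trans (count-suc m′ (λ d → b2n (Q (node (ext p d)))))
                  (cong₂ ℕ._+_ (cong b2n (trans (Q-ext p zero) (cong (_∧ true) Qpar)))
                    (count-zero m′ _ (λ d → cong b2n (trans (Q-ext p (suc d)) (cong (_∧ false) Qpar)))))
  ... | false = count-zero m _ (λ d → cong b2n (trans (Q-ext p d) (cong (_∧ isZero d) Qpar)))

  Q-polar : Polar Q
  Q-polar root     _    = refl
  Q-polar (node p) deg1 with Q (parent p) | count-children-Q p
  ... | true  | children≡1 = ⊥-elim (ℕ.1+n≢n (trans (cong suc (sym children≡1)) deg1))
  ... | false | children≡0 = ⊥-elim (ℕ.0≢1+n (trans (sym children≡0) deg1))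

  cnt-Q-outside : ∀ t p → Q (parent p) ≡ false → Q (node p) ≡ false → cnt Q t (node p) ≡ 0
  cnt-Q-outside zero    p Qpar Qp = cong b2n Qp
  cnt-Q-outside (suc t) p Qpar Qp rewrite Qp = count-zero m _
    (λ d → cnt-Q-outside t (ext p d) Qp (trans (Q-ext p d) (cong (_∧ isZero d) Qpar)))

  mutual
    cnt-Q-in : ∀ t v → Q v ≡ true → cnt Q t v ≡ 1 ℕ.+ arity v ℕ.* geomHalf m t
    cnt-Q-in zero    v Qv rewrite Qv | ℕ.*-zeroʳ (arity v) = refl
    cnt-Q-in (suc t) v Qv rewrite cnt-suc Q t v | Qv = cong suc (count-const (arity v) _ _
      (λ c → cnt-Q-below t (child v c) (trans (cong Q (parent-child v c)) Qv)))

    cnt-Q-below : ∀ t p → Q (parent p) ≡ true → cnt Q t (node p) ≡ geomHalf m (suc t)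
    cnt-Q-below zero    p Qpar = cong b2n (Q-independent p Qpar)
    cnt-Q-below (suc t) p Qpar rewrite Q-independent p Qpar = begin
      count m (λ d → cnt Q t (node (ext p d)))
        ≡⟨ count-suc m′ (λ d → cnt Q t (node (ext p d))) ⟩
      cnt Q t (node (ext p zero)) ℕ.+ count m′ (λ d → cnt Q t (node (ext p (suc d))))
        ≡⟨ cong₂ ℕ._+_ (cnt-Q-in t (node (ext p zero)) first∈Q) (count-zero m′ _ others∉Q) ⟩
      1 ℕ.+ m ℕ.* geomHalf m t ℕ.+ 0
        ≡⟨ ℕ.+-identityʳ _ ⟩
      1 ℕ.+ m ℕ.* geomHalf m t ∎
      where
      open ≡-Reasoning
      first∈Q : Q (node (ext p zero)) ≡ true
      first∈Q = trans (Q-ext p zero) (cong (_∧ true) Qpar)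
      others∉Q : ∀ d → cnt Q t (node (ext p (suc d))) ≡ 0
      others∉Q d = cnt-Q-outside t (ext p (suc d)) (Q-independent p Qpar)
        (trans (Q-ext p (suc d)) (cong (_∧ false) Qpar))

+n+i-nonnegative : ∀ n (i : ℤ) → - (+ n) < i → 0ℤ ≤ℤ + n + i
+n+i-nonnegative n i -n<i = ℤ.<⇒≤ (subst (_< + n + i) (ℤ.+-inverseʳ (+ n)) (ℤ.+-monoʳ-< (+ n) -n<i))

lemma2p12 : (r n : ℕ) (i : ℤ) → 2 ≤ n → - (+ n) < i →
    Σ ℕ λ b → IsBr r ∣ + n + i ∣ (n ∸ 1) b
      × (+ b ≡ + 1 + (+ n + i) * + sum (map (λ j → (n ∸ 1) ^ j) (upTo (r / 2))))
lemma2p12 r n@(suc (suc m′)) i (s≤s (s≤s z≤n)) -n<i =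
  1 ℕ.+ k ℕ.* geomHalf m r ,
  ((Q , Q-polar , refl , cnt-Q-in r root refl) ,
   (λ P polar Proot → LowerBound.cnt-≥-in P polar r root Proot)) ,
  formula
  where
  k : ℕ
  k = ∣ + n + i ∣
  open Extremal k m′
  formula : + (1 ℕ.+ k ℕ.* geomHalf m r) ≡ + 1 + (+ n + i) * + sum (map (m ^_) (upTo (r / 2)))
  formula = begin
    + (1 ℕ.+ k ℕ.* geomHalf m r)   ≡⟨ ℤ.pos-+ 1 _ ⟩
    + 1 + + (k ℕ.* geomHalf m r)   ≡⟨ cong (_+_ (+ 1)) (ℤ.pos-* k _) ⟩
    + 1 + + k * + geomHalf m r     ≡⟨ cong₂ (λ x y → + 1 + x * + y)
                                         (ℤ.0≤i⇒+∣i∣≡i (+n+i-nonnegative n i -n<i)) (geomHalf≡sum m r) ⟩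
    + 1 + (+ n + i) * + sum (map (m ^_) (upTo (r / 2))) ∎
    where open ≡-Reasoning
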